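{- Let $G=(V,E)$ be an undirected graph with $n=|V|$, let $k,\ell\in\mathbb{N}$, and let $\omega\colon E\to\mathbb{Z}$. Define $\mathcal{R}=\{F\subseteq E : |F|=\ell \text{ and } \deg_F(u)\in\{0,2\}\text{ for all } u\in V\}$, $\mathcal{S}=\{F\in\mathcal{R} : \mathtt{cc}(F)\le k\}$, and for $w\in\mathbb{Z}$, $\mathcal{R}_w=\{F\in\mathcal{R}:\omega(F)=w\}$, $\mathcal{S}_w=\{F\in\mathcal{S}:\omega(F)=w\}$, and $\mathcal{C}_w=\{(F,(L,R)) : F\in\mathcal{R}_w \text{ and } (L,R)\text{ is a cut of } V \text{ consistent with } F\}$. Then for every $w\in\mathbb{Z}$, $$|\mathcal{C}_w|\equiv \sum_{F\in\mathcal{S}_w} 2^{\,n-\ell+\mathtt{cc}(F)} \pmod{2^{\,n-\ell+k+1}}.$$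
   Context: For $F\subseteq E$, $\deg_F(u)$ is the number of edges of $F$ incident to $u$, $\omega(F)=\sum_{e\in F}\omega(e)$, and $\mathtt{cc}(F)$ is the number of connected components of the graph formed by the edges of $F$ and the vertices incident to them. A cut of a set $U$ is an ordered pair $(L,R)$ with $L\cap R=\emptyset$ and $L\cup R=U$. A cut $(L,R)$ of $V$ is consistent with $F\subseteq E$ if no edge of $F$ has one endpoint in $L$ and the other in $R$. -}

module Defs where

open import Data.Bool using (Bool; true; false; _∧_; _∨_; not)
open import Data.Nat using (ℕ; zero; suc; _+_; _∸_; _^_; _<ᵇ_; _≡ᵇ_; _≤ᵇ_)
open import Data.Fin using (Fin; toℕ)
import Data.Fin.Properties as FinP
open import Data.Fin.Subset using (Subset; Side; inside; outside; ∣_∣)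
open import Data.Integer as ℤ using (ℤ)
import Data.Integer.Properties as ℤP
open import Data.List using (List; []; _∷_; map; _++_; filterᵇ; length; allFin; cartesianProduct)
open import Data.Bool.ListAction using (any; all)
open import Data.Nat.ListAction using (sum)
open import Data.Vec using (Vec; []; _∷_; lookup)
open import Data.Product using (_×_; _,_; proj₁; proj₂)
open import Data.Sum using (_⊎_)
open import Relation.Nullary.Decidable using (⌊_⌋)
open import Relation.Binary.PropositionalEquality using (_≡_; _≢_)

record Graph (n : ℕ) : Set where
  field
    m      : ℕ
    ends   : Fin m → Fin n × Fin n
    noLoop : ∀ e → proj₁ (ends e) ≢ proj₂ (ends e)
    simple : ∀ e f →
      (proj₁ (ends e) ≡ proj₁ (ends f) × proj₂ (ends e) ≡ proj₂ (ends f)) ⊎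
      (proj₁ (ends e) ≡ proj₂ (ends f) × proj₂ (ends e) ≡ proj₁ (ends f)) →
      e ≡ f

open Graph public

_∈ᵇ_ : ∀ {k} → Fin k → Subset k → Bool
i ∈ᵇ S with lookup S i
... | inside  = true
... | outside = false

_==_ : ∀ {k} → Fin k → Fin k → Bool
i == j = ⌊ i FinP.≟ j ⌋

subsets : (k : ℕ) → List (Subset k)
subsets zero    = [] ∷ []
subsets (suc k) = map (inside ∷_) (subsets k) ++ map (outside ∷_) (subsets k)

count : ∀ {A : Set} → (A → Bool) → List A → ℕ
count p xs = length (filterᵇ p xs)

module _ {n : ℕ} (G : Graph n) where

  EdgeSet : Set
  EdgeSet = Subset (m G)

  incident : Fin n → Fin (m G) → Bool
  incident u e = (u == proj₁ (ends G e)) ∨ (u == proj₂ (ends G e))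

  deg : EdgeSet → Fin n → ℕ
  deg F u = count (λ e → (e ∈ᵇ F) ∧ incident u e) (allFin (m G))

  weight : (Fin (m G) → ℤ) → EdgeSet → ℤ
  weight ω F = Data.List.foldr ℤ._+_ (ℤ.+ 0) (map ω (filterᵇ (_∈ᵇ F) (allFin (m G))))

  reach : EdgeSet → ℕ → Fin n → Fin n → Bool
  reach F zero    u v = u == v
  reach F (suc t) u v = reach F t u v ∨
    any (λ e → (e ∈ᵇ F) ∧
               ((reach F t u (proj₁ (ends G e)) ∧ (v == proj₂ (ends G e))) ∨
                (reach F t u (proj₂ (ends G e)) ∧ (v == proj₁ (ends G e)))))
        (allFin (m G))

  -- u and v are connected in the graph (V , F); walks of length ≤ n suffice
  connected : EdgeSet → Fin n → Fin n → Bool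
  connected F u v = reach F n u v

  touched : EdgeSet → Fin n → Bool
  touched F u = not (deg F u ≡ᵇ 0)

  -- cc(F): number of connected components of the graph formed by the edges
  -- of F and the vertices incident to them, counted by their least vertex.
  cc : EdgeSet → ℕ
  cc F = count (λ u → touched F u ∧
                 all (λ v → not ((toℕ v <ᵇ toℕ u) ∧ touched F v ∧ connected F u v))
                     (allFin n))
               (allFin n)

  inR : ℕ → EdgeSet → Bool
  inR ℓ F = (∣ F ∣ ≡ᵇ ℓ) ∧ all (λ u → (deg F u ≡ᵇ 0) ∨ (deg F u ≡ᵇ 2)) (allFin n)

  inS : ℕ → ℕ → EdgeSet → Bool
  inS k ℓ F = inR ℓ F ∧ (cc F ≤ᵇ k)

  inRw : ℕ → (Fin (m G) → ℤ) → ℤ → EdgeSet → Bool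
  inRw ℓ ω w F = inR ℓ F ∧ ⌊ weight ω F ℤ.≟ w ⌋

  inSw : ℕ → ℕ → (Fin (m G) → ℤ) → ℤ → EdgeSet → Bool
  inSw k ℓ ω w F = inS k ℓ F ∧ ⌊ weight ω F ℤ.≟ w ⌋

  isCut : Subset n × Subset n → Bool
  isCut (L , R) = all (λ u → not ((u ∈ᵇ L) ∧ (u ∈ᵇ R)) ∧ ((u ∈ᵇ L) ∨ (u ∈ᵇ R))) (allFin n)

  consistent : EdgeSet → Subset n × Subset n → Bool
  consistent F (L , R) =
    all (λ e → not ((e ∈ᵇ F) ∧
                    (((proj₁ (ends G e) ∈ᵇ L) ∧ (proj₂ (ends G e) ∈ᵇ R)) ∨
                     ((proj₁ (ends G e) ∈ᵇ R) ∧ (proj₂ (ends G e) ∈ᵇ L)))))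
        (allFin (m G))

  sizeC : ℕ → (Fin (m G) → ℤ) → ℤ → ℕ
  sizeC ℓ ω w =
    count (λ { (F , LR) → inRw ℓ ω w F ∧ isCut LR ∧ consistent F LR })
          (cartesianProduct (subsets (m G))
                            (cartesianProduct (subsets n) (subsets n)))

  sumS : ℕ → ℕ → (Fin (m G) → ℤ) → ℤ → ℕ
  sumS k ℓ ω w = sum (map (λ F → 2 ^ (n ∸ ℓ + cc F)) (filterᵇ (inSw k ℓ ω w) (subsets (m G))))

module Submission where

-- Group the pairs (F , (L , R)) of 𝓒_w by F. A cut (L , R) of V is determined by L
-- (R is its complement), and it is consistent with F exactly when L is constant on the
-- connected components of (V , F). Hence F has 2^c consistent cuts, where c is the
-- number of classes of the relation `connected F` on V. For F ∈ 𝓡 these classes are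
-- the cc(F) components of F and the n - ℓ vertices F does not touch (a 2-regular F with
-- ℓ edges touches exactly ℓ vertices, by the handshake lemma). So F contributes
-- 2^(n-ℓ+cc(F)): its term of the sum when cc(F) ≤ k, a multiple of 2^(n-ℓ+k+1) otherwise.

open import Defs
import Algebra.Properties.CommutativeSemigroup as CSP
open import Data.Bool using (Bool; true; false; T; not; _∧_; _∨_; if_then_else_)
open import Data.Bool.Properties using () renaming (_≟_ to _≟ᵇ_)
open import Data.Empty using (⊥; ⊥-elim)
open import Data.List using (List; []; _∷_; map; _++_; filterᵇ; length; allFin; tabulate; cartesianProduct)
open import Data.List.Properties using (map-cong; map-tabulate; length-filter; length-tabulate)
open import Data.List.Membership.Propositional using (_∈_)
open import Data.List.Membership.Propositional.Properties using (∈-allFin)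
open import Data.List.Relation.Unary.Any using (here; there)
open import Data.Nat using (ℕ; zero; suc; _+_; _∸_; _*_; _^_; _≤_; _<_; z≤n; s≤s; _≡ᵇ_; _<ᵇ_; _≤ᵇ_)
import Data.Nat.Divisibility as ℕ∣
open import Data.Integer using (ℤ)
import Data.Integer.Properties as ℤP
open import Data.Integer.Divisibility using (_∣_)
open import Data.Fin using (Fin; toℕ; inject₁; fromℕ) renaming (zero to fzero; suc to fsuc)
import Data.Fin.Properties as FinP
open import Data.Vec using (Vec; []; _∷_; lookup; _∷ʳ_)
import Data.Vec as Vec
open import Data.Fin.Subset using (Subset; ∣_∣)
open import Relation.Nullary.Decidable
  using (⌊_⌋; ⌊⌋-map′; toWitness; fromWitness; toWitnessFalse; fromWitnessFalse; isYes≗does; does-⇔)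
open import Data.Nat.ListAction using (sum)
open import Data.Nat.Properties
open import Data.Product using (_×_; _,_; proj₁; proj₂; ∃)
open import Data.Sum using (_⊎_; inj₁; inj₂)
open import Data.Bool.ListAction using (all; any)
import Data.List.Relation.Unary.All.Properties as AllP
import Data.List.Relation.Unary.Any.Properties as AnyP
open import Data.Vec.Properties using (∷-injectiveˡ; ∷-injectiveʳ; lookup-map; tabulate∘lookup; tabulate-cong)
open import Function using (_∘_; _⇔_; mk⇔; Equivalence)
open import Relation.Binary.PropositionalEquality
open import Relation.Nullary using (¬_; Dec; yes; no)
open import Relation.Nullary.Decidable.Core using (T?; _×-dec_; _→-dec_)
open import Relation.Binary.Structures using (IsPartialEquivalence)

T-ext : ∀ {x y} → (T x → T y) → (T y → T x) → x ≡ y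
T-ext {true}  {true}  _ _ = refl
T-ext {true}  {false} f _ = ⊥-elim (f _)
T-ext {false} {true}  _ g = ⊥-elim (g _)
T-ext {false} {false} _ _ = refl

-- Introduction and elimination rules for the truth of boolean connectives (the library
-- states them as equivalences, whose implicit arguments are rarely inferable).
T-∧-intro : ∀ {x y} → T x → T y → T (x ∧ y)
T-∧-intro {true} _ ty = ty

T-∧-elim : ∀ {x y} → T (x ∧ y) → T x × T y
T-∧-elim {true} ty = _ , ty

T-∨-introˡ : ∀ {x y} → T x → T (x ∨ y)
T-∨-introˡ {true} _ = _

T-∨-introʳ : ∀ {x y} → T y → T (x ∨ y)
T-∨-introʳ {true}  _  = _
T-∨-introʳ {false} ty = ty

T-∨-elim : ∀ {x y} → T (x ∨ y) → T x ⊎ T y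
T-∨-elim {true}  _  = inj₁ _
T-∨-elim {false} ty = inj₂ ty

T-not : ∀ {b} → T (not b) ⇔ (¬ T b)
T-not {true}  = mk⇔ (λ ()) (λ ¬t → ¬t _)
T-not {false} = mk⇔ (λ _ ()) (λ _ → _)

T-→ : ∀ {a b} → T (not a ∨ b) ⇔ (T a → T b)
T-→ {true}  = mk⇔ (λ tb _ → tb) (λ f → f _)
T-→ {false} = mk⇔ (λ _ ()) (λ _ → _)

indicator : Bool → ℕ
indicator true  = 1
indicator false = 0

module _ {A : Set} where

  count-∷ : ∀ (p : A → Bool) x xs → count p (x ∷ xs) ≡ indicator (p x) + count p xs
  count-∷ p x xs with p x
  ... | true  = refl
  ... | false = refl

  count-as-sum : ∀ (p : A → Bool) xs → count p xs ≡ sum (map (indicator ∘ p) xs)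
  count-as-sum p []       = refl
  count-as-sum p (x ∷ xs) = trans (count-∷ p x xs) (cong (indicator (p x) +_) (count-as-sum p xs))

  count-++ : ∀ (p : A → Bool) xs ys → count p (xs ++ ys) ≡ count p xs + count p ys
  count-++ p []       ys = refl
  count-++ p (x ∷ xs) ys = begin
    count p (x ∷ xs ++ ys)                       ≡⟨ count-∷ p x (xs ++ ys) ⟩
    indicator (p x) + count p (xs ++ ys)         ≡⟨ cong (indicator (p x) +_) (count-++ p xs ys) ⟩
    indicator (p x) + (count p xs + count p ys)  ≡⟨ +-assoc (indicator (p x)) _ _ ⟨
    indicator (p x) + count p xs + count p ys    ≡⟨ cong (_+ count p ys) (count-∷ p x xs) ⟨
    count p (x ∷ xs) + count p ys                ∎
    where open ≡-Reasoning

  count-cong : ∀ {p q : A → Bool} → (∀ x → p x ≡ q x) → ∀ xs → count p xs ≡ count q xs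
  count-cong p≗q []       = refl
  count-cong {p} {q} p≗q (x ∷ xs) =
    trans (count-∷ p x xs) (trans (cong₂ (λ b c → indicator b + c) (p≗q x) (count-cong p≗q xs)) (sym (count-∷ q x xs)))

  count-none : ∀ (p : A → Bool) xs → (∀ x → T (p x) → ⊥) → count p xs ≡ 0
  count-none p xs none = trans (count-cong (λ x → T-ext (none x) λ ()) xs) (count-false xs)
    where
    count-false : ∀ ys → count (λ _ → false) ys ≡ 0
    count-false []       = refl
    count-false (_ ∷ ys) = count-false ys

  sum-cong : ∀ {f g : A → ℕ} → (∀ x → f x ≡ g x) → ∀ xs → sum (map f xs) ≡ sum (map g xs)
  sum-cong f≗g xs = cong sum (map-cong f≗g xs)

  sum-+ : ∀ (f g : A → ℕ) xs → sum (map (λ x → f x + g x) xs) ≡ sum (map f xs) + sum (map g xs)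
  sum-+ f g []       = refl
  sum-+ f g (x ∷ xs) = trans (cong (f x + g x +_) (sum-+ f g xs))
                             (CSP.interchange +-commutativeSemigroup (f x) (g x) _ _)

  sum-scale : ∀ c (f : A → ℕ) xs → sum (map (λ x → c * f x) xs) ≡ c * sum (map f xs)
  sum-scale c f []       = sym (*-zeroʳ c)
  sum-scale c f (x ∷ xs) = trans (cong (c * f x +_) (sum-scale c f xs)) (sym (*-distribˡ-+ c (f x) _))

  count-split : ∀ (p q r : A → Bool) → (∀ x → indicator (p x) ≡ indicator (q x) + indicator (r x)) →
                ∀ xs → count p xs ≡ count q xs + count r xs
  count-split p q r split xs = begin
    count p xs                                             ≡⟨ count-as-sum p xs ⟩
    sum (map (indicator ∘ p) xs)                           ≡⟨ sum-cong split xs ⟩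
    sum (map (λ x → indicator (q x) + indicator (r x)) xs) ≡⟨ sum-+ (indicator ∘ q) (indicator ∘ r) xs ⟩
    sum (map (indicator ∘ q) xs) + sum (map (indicator ∘ r) xs)
                                                   ≡⟨ cong₂ _+_ (count-as-sum q xs) (count-as-sum r xs) ⟨
    count q xs + count r xs                                ∎
    where open ≡-Reasoning

  count-partition : ∀ (t p : A → Bool) xs →
                    count p xs ≡ count (λ x → t x ∧ p x) xs + count (λ x → not (t x) ∧ p x) xs
  count-partition t p = count-split p _ _ split
    where
    split : ∀ x → indicator (p x) ≡ indicator (t x ∧ p x) + indicator (not (t x) ∧ p x)
    split x with t x
    ... | true  = sym (+-identityʳ _)
    ... | false = refl

  count-mono : ∀ {p q : A → Bool} → (∀ x → T (p x) → T (q x)) → ∀ xs → count p xs ≤ count q xs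
  count-mono p⇒q []       = z≤n
  count-mono {p} {q} p⇒q (x ∷ xs) rewrite count-∷ p x xs | count-∷ q x xs with p x in px | q x in qx
  ... | false | _     = ≤-trans (count-mono p⇒q xs) (m≤n+m _ _)
  ... | true  | true  = s≤s (count-mono p⇒q xs)
  ... | true  | false = ⊥-elim (subst T qx (p⇒q x (subst T (sym px) _)))

  count-strict-mono : ∀ {p q : A → Bool} → (∀ x → T (p x) → T (q x)) →
                      ∀ {x xs} → x ∈ xs → T (q x) → ¬ T (p x) → count p xs < count q xs
  count-strict-mono {p} {q} p⇒q {x} {y ∷ xs} (here refl) qx ¬px
    rewrite count-∷ p x xs | count-∷ q x xs with p x | q x
  ... | true  | _     = ⊥-elim (¬px _)
  ... | false | false = ⊥-elim qx
  ... | false | true  = s≤s (count-mono p⇒q xs)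
  count-strict-mono {p} {q} p⇒q {x} {y ∷ xs} (there x∈xs) qx ¬px
    rewrite count-∷ p y xs | count-∷ q y xs = +-mono-≤-< (indicator-mono (p⇒q y)) (count-strict-mono p⇒q x∈xs qx ¬px)
    where
    indicator-mono : ∀ {b c} → (T b → T c) → indicator b ≤ indicator c
    indicator-mono {false} _ = z≤n
    indicator-mono {true} {true} _ = s≤s z≤n
    indicator-mono {true} {false} f = ⊥-elim (f _)

  count-pos : ∀ (p : A → Bool) {x xs} → x ∈ xs → T (p x) → 0 < count p xs
  count-pos p x∈xs px = ≤-trans (s≤s z≤n) (count-strict-mono {p = λ _ → false} {q = p} (λ _ ()) x∈xs px (λ ()))

  count-complement : ∀ (p : A → Bool) xs → count p xs + count (not ∘ p) xs ≡ length xs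
  count-complement p []       = refl
  count-complement p (x ∷ xs) rewrite count-∷ p x xs | count-∷ (not ∘ p) x xs with p x
  ... | true  = cong suc (count-complement p xs)
  ... | false = trans (+-suc _ _) (cong suc (count-complement p xs))

  count-guarded : ∀ b (p : A → Bool) xs → count (λ x → b ∧ p x) xs ≡ (if b then count p xs else 0)
  count-guarded true  p xs = refl
  count-guarded false p xs = count-none (λ _ → false) xs (λ _ ())

  sum-filter : ∀ (p : A → Bool) (g : A → ℕ) xs → sum (map g (filterᵇ p xs)) ≡ sum (map (λ x → if p x then g x else 0) xs)
  sum-filter p g []       = refl
  sum-filter p g (x ∷ xs) with p x
  ... | true  = cong (g x +_) (sum-filter p g xs)
  ... | false = sum-filter p g xs

  count-≤-length : ∀ (p : A → Bool) xs → count p xs ≤ length xs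
  count-≤-length p = length-filter (T? ∘ p)

  sum-zero : ∀ xs → sum (map (λ (_ : A) → 0) xs) ≡ 0
  sum-zero []       = refl
  sum-zero (_ ∷ xs) = sum-zero xs

count-map : ∀ {A B : Set} (p : B → Bool) (f : A → B) xs → count p (map f xs) ≡ count (p ∘ f) xs
count-map p f []       = refl
count-map p f (x ∷ xs) = trans (count-∷ p (f x) (map f xs))
  (trans (cong (indicator (p (f x)) +_) (count-map p f xs)) (sym (count-∷ (p ∘ f) x xs)))

module _ {A B : Set} where

  count-cartesianProduct : ∀ (p : A × B → Bool) xs ys →
    count p (cartesianProduct xs ys) ≡ sum (map (λ x → count (λ y → p (x , y)) ys) xs)
  count-cartesianProduct p []       ys = refl
  count-cartesianProduct p (x ∷ xs) ys =
    trans (count-++ p (map (x ,_) ys) _) (cong₂ _+_ (count-map p (x ,_) ys) (count-cartesianProduct p xs ys))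

  count-swap : ∀ (r : A → B → Bool) xs ys →
    sum (map (λ x → count (r x) ys) xs) ≡ sum (map (λ y → count (λ x → r x y) xs) ys)
  count-swap r []       ys = sym (sum-zero ys)
  count-swap r (x ∷ xs) ys = begin
    count (r x) ys + sum (map (λ x → count (r x) ys) xs)
      ≡⟨ cong (count (r x) ys +_) (count-swap r xs ys) ⟩
    count (r x) ys + sum (map (λ y → count (λ x → r x y) xs) ys)
      ≡⟨ cong (_+ _) (count-as-sum (r x) ys) ⟩
    sum (map (indicator ∘ r x) ys) + sum (map (λ y → count (λ x → r x y) xs) ys)
      ≡⟨ sum-+ (indicator ∘ r x) (λ y → count (λ x → r x y) xs) ys ⟨
    sum (map (λ y → indicator (r x y) + count (λ x → r x y) xs) ys)
      ≡⟨ sum-cong (λ y → count-∷ (λ x → r x y) x xs) ys ⟨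
    sum (map (λ y → count (λ x → r x y) (x ∷ xs)) ys) ∎
    where open ≡-Reasoning

all-allFin : ∀ {k} (p : Fin k → Bool) → T (all p (allFin k)) ⇔ (∀ i → T (p i))
all-allFin p = mk⇔ (AllP.tabulate⁻ ∘ AllP.all⁺ p _) (AllP.all⁻ p ∘ AllP.tabulate⁺)

any-allFin : ∀ {k} (p : Fin k → Bool) → T (any p (allFin k)) ⇔ ∃ (λ i → T (p i))
any-allFin p = mk⇔ (AnyP.tabulate⁻ ∘ AnyP.any⁻ p _) (λ (i , pi) → AnyP.any⁺ p (AnyP.tabulate⁺ i pi))

⌊⌋-cong : ∀ {P Q : Set} → P ⇔ Q → (p? : Dec P) (q? : Dec Q) → ⌊ p? ⌋ ≡ ⌊ q? ⌋
⌊⌋-cong P⇔Q p? q? = trans (isYes≗does p?) (trans (does-⇔ P⇔Q p? q?) (sym (isYes≗does q?)))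

count-tabulate : ∀ {A : Set} {k} (p : A → Bool) (f : Fin k → A) → count p (tabulate f) ≡ count (p ∘ f) (allFin k)
count-tabulate p f = trans (cong (count p) (sym (map-tabulate (λ i → i) f))) (count-map p f (allFin _))

data LastView {k : ℕ} : Fin (suc k) → Set where
  inner : (i : Fin k) → LastView (inject₁ i)
  last  : LastView (fromℕ k)

lastView : ∀ {k} (i : Fin (suc k)) → LastView i
lastView {zero}  fzero    = last
lastView {suc k} fzero    = inner fzero
lastView {suc k} (fsuc i) with lastView i
... | inner j = inner (fsuc j)
... | last    = last

count-allFin-∷ʳ : ∀ k (p : Fin (suc k) → Bool) →
                  count p (allFin (suc k)) ≡ count (p ∘ inject₁) (allFin k) + indicator (p (fromℕ k))
count-allFin-∷ʳ zero    p = trans (count-∷ p fzero []) (+-identityʳ _)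
count-allFin-∷ʳ (suc k) p = begin
  count p (allFin (suc (suc k)))
    ≡⟨ count-∷ p fzero (tabulate fsuc) ⟩
  indicator (p fzero) + count p (tabulate fsuc)
    ≡⟨ cong (indicator (p fzero) +_) (trans (count-tabulate p fsuc) (count-allFin-∷ʳ k (p ∘ fsuc))) ⟩
  indicator (p fzero) + (count (p ∘ fsuc ∘ inject₁) (allFin k) + indicator (p (fromℕ (suc k))))
    ≡⟨ +-assoc (indicator (p fzero)) _ _ ⟨
  indicator (p fzero) + count (p ∘ inject₁ ∘ fsuc) (allFin k) + indicator (p (fromℕ (suc k)))
    ≡⟨ cong (λ c → indicator (p fzero) + c + indicator (p (fromℕ (suc k)))) (count-tabulate (p ∘ inject₁) fsuc) ⟨
  indicator (p fzero) + count (p ∘ inject₁) (tabulate fsuc) + indicator (p (fromℕ (suc k)))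
    ≡⟨ cong (_+ indicator (p (fromℕ (suc k)))) (count-∷ (p ∘ inject₁) fzero (tabulate fsuc)) ⟨
  count (p ∘ inject₁) (allFin (suc k)) + indicator (p (fromℕ (suc k))) ∎
  where open ≡-Reasoning

count-allFin-single : ∀ {k} (a : Fin k) → count (_== a) (allFin k) ≡ 1
count-allFin-single {suc k} a =
  trans (count-∷ (_== a) fzero (tabulate fsuc)) (trans (cong (indicator (fzero == a) +_) (count-tabulate (_== a) fsuc)) (split a))
  where
  split : ∀ a → indicator (fzero == a) + count (λ i → fsuc i == a) (allFin k) ≡ 1
  split fzero    = cong suc (count-none (λ i → fsuc i == fzero) (allFin k) λ _ ())
  split (fsuc a) = trans (count-cong (λ i → ⌊⌋-map′ _ _ (i FinP.≟ a)) (allFin k)) (count-allFin-single a)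

vec-ext : ∀ {A : Set} {k} {X Y : Vec A k} → (∀ i → lookup X i ≡ lookup Y i) → X ≡ Y
vec-ext {X = X} {Y} same = trans (sym (tabulate∘lookup X)) (trans (tabulate-cong same) (tabulate∘lookup Y))

∈ᵇ-lookup : ∀ {k} (i : Fin k) (S : Subset k) → i ∈ᵇ S ≡ lookup S i
∈ᵇ-lookup i S with lookup S i
... | true  = refl
... | false = refl

∣∣-as-count : ∀ {k} (S : Subset k) → ∣ S ∣ ≡ count (_∈ᵇ S) (allFin k)
∣∣-as-count S = trans (size-lookup S) (count-cong (λ i → sym (∈ᵇ-lookup i S)) (allFin _))
  where
  size-lookup : ∀ {k} (S : Subset k) → ∣ S ∣ ≡ count (lookup S) (allFin k)
  size-lookup []      = refl
  size-lookup (x ∷ S) = begin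
    ∣ x ∷ S ∣                                           ≡⟨ size-cons x ⟩
    indicator x + ∣ S ∣                                 ≡⟨ cong (indicator x +_) (size-lookup S) ⟩
    indicator x + count (lookup S) (allFin _)           ≡⟨ cong (indicator x +_) (count-tabulate (lookup (x ∷ S)) fsuc) ⟨
    indicator x + count (lookup (x ∷ S)) (tabulate fsuc) ≡⟨ count-∷ (lookup (x ∷ S)) fzero (tabulate fsuc) ⟨
    count (lookup (x ∷ S)) (allFin _)                   ∎
    where
    open ≡-Reasoning
    size-cons : ∀ x → ∣ x ∷ S ∣ ≡ indicator x + ∣ S ∣
    size-cons true  = refl
    size-cons false = refl

count-subsets-∷ : ∀ {k} (p : Subset (suc k) → Bool) →
  count p (subsets (suc k)) ≡ count (p ∘ (true ∷_)) (subsets k) + count (p ∘ (false ∷_)) (subsets k)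
count-subsets-∷ {k} p =
  trans (count-++ p (map (true ∷_) (subsets k)) _) (cong₂ _+_ (count-map p _ (subsets k)) (count-map p _ (subsets k)))

count-subsets-∷ʳ : ∀ k (p : Subset (suc k) → Bool) →
  count p (subsets (suc k)) ≡ count (λ L → p (L ∷ʳ true)) (subsets k) + count (λ L → p (L ∷ʳ false)) (subsets k)
count-subsets-∷ʳ zero    p = trans (count-subsets-∷ p) (cong₂ _+_ (at-end true) (at-end false))
  where
  at-end : ∀ x → count (p ∘ (x ∷_)) (subsets zero) ≡ count (λ L → p (L ∷ʳ x)) (subsets zero)
  at-end x = count-cong {p = p ∘ (x ∷_)} {q = λ L → p (L ∷ʳ x)} (λ { [] → refl }) (subsets zero)
count-subsets-∷ʳ (suc k) p = begin
  count p (subsets (suc (suc k)))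
    ≡⟨ count-subsets-∷ p ⟩
  count (p ∘ (true ∷_)) (subsets (suc k)) + count (p ∘ (false ∷_)) (subsets (suc k))
    ≡⟨ cong₂ _+_ (count-subsets-∷ʳ k (p ∘ (true ∷_))) (count-subsets-∷ʳ k (p ∘ (false ∷_))) ⟩
  (count (λ L → p (true ∷ (L ∷ʳ true))) S + count (λ L → p (true ∷ (L ∷ʳ false))) S) +
  (count (λ L → p (false ∷ (L ∷ʳ true))) S + count (λ L → p (false ∷ (L ∷ʳ false))) S)
    ≡⟨ CSP.interchange +-commutativeSemigroup (count (λ L → p (true ∷ (L ∷ʳ true))) S) _ _ _ ⟩
  (count (λ L → p (true ∷ (L ∷ʳ true))) S + count (λ L → p (false ∷ (L ∷ʳ true))) S) +
  (count (λ L → p (true ∷ (L ∷ʳ false))) S + count (λ L → p (false ∷ (L ∷ʳ false))) S)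
    ≡⟨ cong₂ _+_ (count-subsets-∷ (λ L → p (L ∷ʳ true))) (count-subsets-∷ (λ L → p (L ∷ʳ false))) ⟨
  count (λ L → p (L ∷ʳ true)) (subsets (suc k)) + count (λ L → p (L ∷ʳ false)) (subsets (suc k)) ∎
  where
  open ≡-Reasoning
  S : List (Subset k)
  S = subsets k

count-subsets-unique : ∀ {k} (p : Subset k → Bool) (X : Subset k) →
  (∀ R → T (p R) → R ≡ X) → count p (subsets k) ≡ indicator (p X)

same-head : ∀ {k} (p : Subset (suc k) → Bool) x X → (∀ R → T (p R) → R ≡ x ∷ X) →
            count (p ∘ (x ∷_)) (subsets k) ≡ indicator (p (x ∷ X))
same-head p x X unique = count-subsets-unique (p ∘ (x ∷_)) X (λ R pR → ∷-injectiveʳ (unique _ pR))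

other-head : ∀ {k} (p : Subset (suc k) → Bool) x X → (∀ R → T (p R) → R ≡ x ∷ X) →
             ∀ y → y ≢ x → count (p ∘ (y ∷_)) (subsets k) ≡ 0
other-head {k} p x X unique y y≢x = count-none (p ∘ (y ∷_)) (subsets k) λ R pR → y≢x (∷-injectiveˡ (unique _ pR))

count-subsets-unique p []      _      = trans (count-∷ p [] []) (+-identityʳ _)
count-subsets-unique p (true ∷ X) unique =
  trans (count-subsets-∷ p) (trans (cong₂ _+_ (same-head p true X unique) (other-head p true X unique false λ ())) (+-identityʳ _))
count-subsets-unique {suc k} p (false ∷ X) unique =
  trans (count-subsets-∷ p)
        (trans (cong (_+ count (p ∘ (false ∷_)) (subsets k)) (other-head p false X unique true λ ())) (same-head p false X unique))

-- A boolean relation C on Fin k, seen as a proposition. Labelings L : Subset k constant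
-- on the classes of a partial equivalence C are counted via the least element of each class.
Related : ∀ {k} → (Fin k → Fin k → Bool) → Fin k → Fin k → Set
Related C u v = T (C u v)

module _ {k : ℕ} (C : Fin k → Fin k → Bool) where

  Constant : Subset k → Set
  Constant L = ∀ u v → T (C u v) → lookup L u ≡ lookup L v

  constant? : Subset k → Bool
  constant? L = ⌊ FinP.all? (λ u → FinP.all? (λ v → T? (C u v) →-dec (lookup L u ≟ᵇ lookup L v))) ⌋

  HasSmallerMate : Fin k → Set
  HasSmallerMate u = ∃ λ v → toℕ v < toℕ u × T (C u v)

  smallerMate? : ∀ u → Dec (HasSmallerMate u)
  smallerMate? u = FinP.any? (λ v → (toℕ v <? toℕ u) ×-dec T? (C u v))

  least? : Fin k → Bool
  least? u = not ⌊ smallerMate? u ⌋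

  least⇔ : ∀ u → T (least? u) ⇔ (¬ HasSmallerMate u)
  least⇔ u = mk⇔ toWitnessFalse fromWitnessFalse

  classes : ℕ
  classes = count least? (allFin k)

restrict : ∀ {k} → (Fin (suc k) → Fin (suc k) → Bool) → Fin k → Fin k → Bool
restrict C u v = C (inject₁ u) (inject₁ v)

lookup-∷ʳ-inject₁ : ∀ {A : Set} {k} (L : Vec A k) x (i : Fin k) → lookup (L ∷ʳ x) (inject₁ i) ≡ lookup L i
lookup-∷ʳ-inject₁ (y ∷ L) x fzero    = refl
lookup-∷ʳ-inject₁ (y ∷ L) x (fsuc i) = lookup-∷ʳ-inject₁ L x i

lookup-∷ʳ-last : ∀ {A : Set} {k} (L : Vec A k) x → lookup (L ∷ʳ x) (fromℕ k) ≡ x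
lookup-∷ʳ-last []      x = refl
lookup-∷ʳ-last (y ∷ L) x = lookup-∷ʳ-last L x

module LastElement {k : ℕ} (C : Fin (suc k) → Fin (suc k) → Bool) where

  lastElem : Fin (suc k)
  lastElem = fromℕ k

  inner<last : ∀ (v : Fin k) → toℕ (inject₁ v) < toℕ lastElem
  inner<last v = subst (toℕ (inject₁ v) <_) (sym (FinP.toℕ-fromℕ k)) (FinP.inject₁ℕ< v)

  restrict-equiv : IsPartialEquivalence (Related C) → IsPartialEquivalence (Related (restrict C))
  restrict-equiv eqv = record { sym = IsPartialEquivalence.sym eqv ; trans = IsPartialEquivalence.trans eqv }

  least?-inject₁ : ∀ u → least? C (inject₁ u) ≡ least? (restrict C) u
  least?-inject₁ u = cong not (⌊⌋-cong (mk⇔ to from) (smallerMate? C (inject₁ u)) (smallerMate? (restrict C) u))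
    where
    to : HasSmallerMate C (inject₁ u) → HasSmallerMate (restrict C) u
    to (v , v<u , c) with lastView v
    ... | inner w = w , subst₂ _<_ (FinP.toℕ-inject₁ w) (FinP.toℕ-inject₁ u) v<u , c
    ... | last    = ⊥-elim (<-asym v<u (inner<last u))
    from : HasSmallerMate (restrict C) u → HasSmallerMate C (inject₁ u)
    from (w , w<u , c) = inject₁ w , subst₂ _<_ (sym (FinP.toℕ-inject₁ w)) (sym (FinP.toℕ-inject₁ u)) w<u , c

  classes-∷ʳ : classes C ≡ classes (restrict C) + indicator (least? C lastElem)
  classes-∷ʳ = trans (count-allFin-∷ʳ k (least? C)) (cong (_+ indicator (least? C lastElem)) (count-cong least?-inject₁ (allFin k)))

  constant-restrict : ∀ L x → Constant C (L ∷ʳ x) → Constant (restrict C) L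
  constant-restrict L x K u v c =
    trans (sym (lookup-∷ʳ-inject₁ L x u)) (trans (K (inject₁ u) (inject₁ v) c) (lookup-∷ʳ-inject₁ L x v))

  constant-extend : IsPartialEquivalence (Related C) → ∀ L x → Constant (restrict C) L →
    (∀ v → T (C lastElem (inject₁ v)) → x ≡ lookup L v) → Constant C (L ∷ʳ x)
  constant-extend eqv L x K agree u v c with lastView u | lastView v
  ... | inner u′ | inner v′ = trans (lookup-∷ʳ-inject₁ L x u′) (trans (K u′ v′ c) (sym (lookup-∷ʳ-inject₁ L x v′)))
  ... | last     | last     = refl
  ... | last     | inner v′ = trans (lookup-∷ʳ-last L x) (trans (agree v′ c) (sym (lookup-∷ʳ-inject₁ L x v′)))
  ... | inner u′ | last     =
    trans (lookup-∷ʳ-inject₁ L x u′) (trans (sym (agree u′ (IsPartialEquivalence.sym eqv c))) (sym (lookup-∷ʳ-last L x)))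

  constant?-∷ʳ-least : IsPartialEquivalence (Related C) → ¬ HasSmallerMate C lastElem →
                       ∀ L x → constant? C (L ∷ʳ x) ≡ constant? (restrict C) L
  constant?-∷ʳ-least eqv noMate L x = ⌊⌋-cong (mk⇔ (constant-restrict L x) extend) _ _
    where
    extend : Constant (restrict C) L → Constant C (L ∷ʳ x)
    extend K = constant-extend eqv L x K λ v c → ⊥-elim (noMate (inject₁ v , inner<last v , c))

  constant?-∷ʳ-mate : IsPartialEquivalence (Related C) → ∀ w → T (C lastElem (inject₁ w)) →
                      ∀ L x → constant? C (L ∷ʳ x) ≡ ⌊ x ≟ᵇ lookup L w ⌋ ∧ constant? (restrict C) L
  constant?-∷ʳ-mate eqv w c L x = T-ext to from
    where
    to : T (constant? C (L ∷ʳ x)) → T (⌊ x ≟ᵇ lookup L w ⌋ ∧ constant? (restrict C) L)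
    to K = T-∧-intro {⌊ x ≟ᵇ lookup L w ⌋} (fromWitness x≡w) (fromWitness (constant-restrict L x (toWitness K)))
      where
      x≡w : x ≡ lookup L w
      x≡w = trans (sym (lookup-∷ʳ-last L x)) (trans (toWitness K lastElem (inject₁ w) c) (lookup-∷ʳ-inject₁ L x w))
    from : T (⌊ x ≟ᵇ lookup L w ⌋ ∧ constant? (restrict C) L) → T (constant? C (L ∷ʳ x))
    from h with T-∧-elim {⌊ x ≟ᵇ lookup L w ⌋} h
    ... | x≡w , K = fromWitness (constant-extend eqv L x (toWitness K)
          λ v c′ → trans (toWitness x≡w) (toWitness K w v (IsPartialEquivalence.trans eqv (IsPartialEquivalence.sym eqv c) c′)))

⌊true≟⌋ : ∀ b → ⌊ true ≟ᵇ b ⌋ ≡ b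
⌊true≟⌋ true  = refl
⌊true≟⌋ false = refl

⌊false≟⌋ : ∀ b → ⌊ false ≟ᵇ b ⌋ ≡ not b
⌊false≟⌋ true  = refl
⌊false≟⌋ false = refl

module Extensions {k : ℕ} (C : Fin (suc k) → Fin (suc k) → Bool) (eqv : IsPartialEquivalence (Related C)) where
  open LastElement C

  extensions : ℕ
  extensions = count (λ L → constant? C (L ∷ʳ true)) (subsets k) + count (λ L → constant? C (L ∷ʳ false)) (subsets k)

  extensions-free : ¬ HasSmallerMate C lastElem →
                    extensions ≡ count (constant? (restrict C)) (subsets k) + count (constant? (restrict C)) (subsets k)
  extensions-free noMate = cong₂ _+_ (count-cong (λ L → constant?-∷ʳ-least eqv noMate L true) (subsets k))
                                     (count-cong (λ L → constant?-∷ʳ-least eqv noMate L false) (subsets k))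

  extensions-forced : ∀ w → T (C lastElem (inject₁ w)) → extensions ≡ count (constant? (restrict C)) (subsets k)
  extensions-forced w c = begin
    extensions
      ≡⟨ cong₂ _+_ (count-cong (λ L → trans (constant?-∷ʳ-mate eqv w c L true) (cong (_∧ _) (⌊true≟⌋ (lookup L w)))) (subsets k))
                   (count-cong (λ L → trans (constant?-∷ʳ-mate eqv w c L false) (cong (_∧ _) (⌊false≟⌋ (lookup L w)))) (subsets k)) ⟩
    count (λ L → lookup L w ∧ constant? (restrict C) L) (subsets k) + count (λ L → not (lookup L w) ∧ constant? (restrict C) L) (subsets k)
      ≡⟨ count-partition (λ L → lookup L w) (constant? (restrict C)) (subsets k) ⟨
    count (constant? (restrict C)) (subsets k) ∎
    where open ≡-Reasoning

-- Induction on k: the last element either starts a new class (its label is free,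
-- doubling the count) or is related to a smaller element (its label is forced).
count-constant : ∀ k (C : Fin k → Fin k → Bool) → IsPartialEquivalence (Related C) →
                 count (constant? C) (subsets k) ≡ 2 ^ classes C
count-constant zero    C eqv = refl
count-constant (suc k) C eqv = begin
  count (constant? C) (subsets (suc k))             ≡⟨ count-subsets-∷ʳ k (constant? C) ⟩
  extensions                                        ≡⟨ by-last-element (smallerMate? C lastElem) ⟩
  2 ^ (classes C′ + indicator (least? C lastElem))  ≡⟨ cong (2 ^_) classes-∷ʳ ⟨
  2 ^ classes C                                     ∎
  where
  open ≡-Reasoning
  open LastElement C
  open Extensions C eqv
  C′ : Fin k → Fin k → Bool
  C′ = restrict C
  IH : count (constant? C′) (subsets k) ≡ 2 ^ classes C′
  IH = count-constant k C′ (restrict-equiv eqv)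
  by-last-element : (m? : Dec (HasSmallerMate C lastElem)) → extensions ≡ 2 ^ (classes C′ + indicator (not ⌊ m? ⌋))
  by-last-element (no noMate) = begin
    extensions                       ≡⟨ extensions-free noMate ⟩
    count (constant? C′) (subsets k) + count (constant? C′) (subsets k)
                                     ≡⟨ cong₂ _+_ IH (trans IH (sym (+-identityʳ (2 ^ classes C′)))) ⟩
    2 ^ suc (classes C′)             ≡⟨ cong (2 ^_) (+-comm 1 (classes C′)) ⟩
    2 ^ (classes C′ + 1)             ∎
  by-last-element (yes (v , v<last , c)) with lastView v
  ... | last    = ⊥-elim (<-irrefl refl v<last)
  ... | inner w = trans (extensions-forced w c) (trans IH (cong (2 ^_) (sym (+-identityʳ (classes C′)))))

module Endpoints {n : ℕ} (G : Graph n) where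

  src tgt : Fin (m G) → Fin n
  src e = proj₁ (ends G e)
  tgt e = proj₂ (ends G e)

module Connectivity {n : ℕ} (G : Graph n) (F : EdgeSet G) where
  open Endpoints G public

  Adjacent : Fin n → Fin n → Set
  Adjacent u v = ∃ λ e → T (e ∈ᵇ F) × ((src e ≡ u × tgt e ≡ v) ⊎ (tgt e ≡ u × src e ≡ v))

  adjacent-sym : ∀ {u v} → Adjacent u v → Adjacent v u
  adjacent-sym (e , e∈F , inj₁ (p , q)) = e , e∈F , inj₂ (q , p)
  adjacent-sym (e , e∈F , inj₂ (p , q)) = e , e∈F , inj₁ (q , p)

  data Walk (u : Fin n) : Fin n → Set where
    stay : Walk u u
    _▹_  : ∀ {x v} → Walk u x → Adjacent x v → Walk u v

  _++ʷ_ : ∀ {u x v} → Walk u x → Walk x v → Walk u v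
  p ++ʷ stay    = p
  p ++ʷ (q ▹ a) = (p ++ʷ q) ▹ a

  reverse : ∀ {u v} → Walk u v → Walk v u
  reverse stay    = stay
  reverse (p ▹ a) = (stay ▹ adjacent-sym a) ++ʷ reverse p

  reach-suc-mono : ∀ {t u v} → T (reach G F t u v) → T (reach G F (suc t) u v)
  reach-suc-mono = T-∨-introˡ

  reach-step : ∀ {t u x v} → T (reach G F t u x) → Adjacent x v → T (reach G F (suc t) u v)
  reach-step {t} {u} {x} {v} r (e , e∈F , ends≡) =
    T-∨-introʳ {reach G F t u v} (Equivalence.from (any-allFin _) (e , T-∧-intro e∈F (step ends≡)))
    where
    step : (src e ≡ x × tgt e ≡ v) ⊎ (tgt e ≡ x × src e ≡ v) →
           T ((reach G F t u (src e) ∧ (v == tgt e)) ∨ (reach G F t u (tgt e) ∧ (v == src e)))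
    step (inj₁ (refl , refl)) = T-∨-introˡ (T-∧-intro r (fromWitness refl))
    step (inj₂ (refl , refl)) = T-∨-introʳ {reach G F t u (src e) ∧ (v == tgt e)} (T-∧-intro r (fromWitness refl))

  reach-suc-elim : ∀ {t u v} → T (reach G F (suc t) u v) →
                   T (reach G F t u v) ⊎ ∃ λ x → T (reach G F t u x) × Adjacent x v
  reach-suc-elim {t} {u} {v} r with T-∨-elim {reach G F t u v} r
  ... | inj₁ r′ = inj₁ r′
  ... | inj₂ r′ with Equivalence.to (any-allFin _) r′
  ...   | e , h with T-∧-elim {e ∈ᵇ F} h
  ...     | e∈F , h′ with T-∨-elim {reach G F t u (src e) ∧ (v == tgt e)} h′
  ...       | inj₁ h″ = let (r″ , v≡) = T-∧-elim {reach G F t u (src e)} h″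
                        in inj₂ (src e , r″ , e , e∈F , inj₁ (refl , sym (toWitness v≡)))
  ...       | inj₂ h″ = let (r″ , v≡) = T-∧-elim {reach G F t u (tgt e)} h″
                        in inj₂ (tgt e , r″ , e , e∈F , inj₂ (refl , sym (toWitness v≡)))

  walk-of-reach : ∀ t {u v} → T (reach G F t u v) → Walk u v
  walk-of-reach zero {u} {v} r with toWitness {a? = u FinP.≟ v} r
  ... | refl = stay
  walk-of-reach (suc t) r with reach-suc-elim {t} r
  ... | inj₁ r′              = walk-of-reach t r′
  ... | inj₂ (x , r′ , adj) = walk-of-reach t r′ ▹ adj

  reach-of-walk : ∀ {u v} → Walk u v → ∃ λ t → T (reach G F t u v)
  reach-of-walk {u} stay  = 0 , fromWitness {a? = u FinP.≟ u} refl
  reach-of-walk (p ▹ adj) = let (t , r) = reach-of-walk p in suc t , reach-step {t} r adj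

  -- Walks of length at most n suffice: the set reached within t steps grows
  -- strictly until it is closed under one more step, and it has at most n elements.
  Closed : ℕ → Fin n → Set
  Closed t u = ∀ v → T (reach G F (suc t) u v) → T (reach G F t u v)

  closed? : ∀ t u → Dec (Closed t u)
  closed? t u = FinP.all? (λ v → T? (reach G F (suc t) u v) →-dec T? (reach G F t u v))

  reach-+ : ∀ j {t u v} → T (reach G F t u v) → T (reach G F (j + t) u v)
  reach-+ zero        r = r
  reach-+ (suc j) {t} r = reach-suc-mono {j + t} (reach-+ j r)

  closed-stable : ∀ {t u} → Closed t u → ∀ j {v} → T (reach G F (j + t) u v) → T (reach G F t u v)
  closed-stable         closed zero    r = r
  closed-stable {t} {u} closed (suc j) r with reach-suc-elim {j + t} r
  ... | inj₁ r′              = closed-stable closed j r′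
  ... | inj₂ (x , r′ , adj) = closed _ (reach-step {t} (closed-stable closed j {x} r′) adj)

  closed-suc : ∀ {t u} → Closed t u → Closed (suc t) u
  closed-suc {t} {u} closed v r = reach-suc-mono {t} (closed-stable {t} {u} closed 2 r)

  reached : ℕ → Fin n → ℕ
  reached t u = count (reach G F t u) (allFin n)

  growth : ∀ t u → Closed t u ⊎ t < reached t u
  growth zero    u = inj₂ (count-pos (reach G F 0 u) (∈-allFin u) (fromWitness {a? = u FinP.≟ u} refl))
  growth (suc t) u with growth t u | closed? t u
  ... | inj₁ closed | _          = inj₁ (closed-suc {t} closed)
  ... | inj₂ _      | yes closed = inj₁ (closed-suc {t} closed)
  ... | inj₂ t<r    | no ¬closed =
    let (v , new) = FinP.¬∀⟶∃¬ n _ (λ v → T? (reach G F (suc t) u v) →-dec T? (reach G F t u v)) ¬closed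
        (r₁ , ¬r₀) = newly-reached new
    in inj₂ (≤-<-trans t<r (count-strict-mono (λ _ → reach-suc-mono {t}) (∈-allFin v) r₁ ¬r₀))
    where
    newly-reached : ∀ {a b} → ¬ (T a → T b) → T a × ¬ T b
    newly-reached {true}  {false} _   = _ , λ ()
    newly-reached {true}  {true}  ¬ab = ⊥-elim (¬ab _)
    newly-reached {false}         ¬ab = ⊥-elim (¬ab λ ())

  closed-at-n : ∀ u → Closed n u
  closed-at-n u with growth n u
  ... | inj₁ closed = closed
  ... | inj₂ n<r    = ⊥-elim (<⇒≱ n<r (subst (reached n u ≤_) (length-tabulate (λ i → i)) (count-≤-length _ (allFin n))))

  reach-within-n : ∀ t {u v} → T (reach G F t u v) → T (connected G F u v)
  reach-within-n t {u} {v} r = closed-stable (closed-at-n u) t (subst (λ s → T (reach G F s u v)) (+-comm n t) (reach-+ n r))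

  connected⇔walk : ∀ {u v} → T (connected G F u v) ⇔ Walk u v
  connected⇔walk = mk⇔ (walk-of-reach n) (λ p → let (t , r) = reach-of-walk p in reach-within-n t r)

  connected-equiv : IsPartialEquivalence (Related (connected G F))
  connected-equiv = record
    { sym   = λ c → Equivalence.from connected⇔walk (reverse (Equivalence.to connected⇔walk c))
    ; trans = λ c d → Equivalence.from connected⇔walk (Equivalence.to connected⇔walk c ++ʷ Equivalence.to connected⇔walk d)
    }

  adjacent-touched : ∀ {x v} → Adjacent x v → T (touched G F v)
  adjacent-touched {x} {v} (e , e∈F , ends≡) =
    positive (count-pos (λ e → (e ∈ᵇ F) ∧ incident G v e) (∈-allFin e) (T-∧-intro {e ∈ᵇ F} e∈F (incident-end ends≡)))
    where
    positive : ∀ {d} → 0 < d → T (not (d ≡ᵇ 0))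
    positive {suc d} _ = _
    incident-end : (src e ≡ x × tgt e ≡ v) ⊎ (tgt e ≡ x × src e ≡ v) → T (incident G v e)
    incident-end (inj₁ (_ , refl)) = T-∨-introʳ {v == src e} (fromWitness {a? = v FinP.≟ v} refl)
    incident-end (inj₂ (_ , refl)) = T-∨-introˡ (fromWitness {a? = v FinP.≟ v} refl)

  walk-end-touched : ∀ {u v} → Walk u v → u ≢ v → T (touched G F v)
  walk-end-touched stay      u≢u = ⊥-elim (u≢u refl)
  walk-end-touched (_ ▹ adj) _   = adjacent-touched adj

complement : ∀ {k} → Subset k → Subset k
complement = Vec.map not

cut-identity : ∀ x y → not (x ∧ y) ∧ (x ∨ y) ≡ ⌊ y ≟ᵇ not x ⌋
cut-identity true  true  = refl
cut-identity true  false = refl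
cut-identity false true  = refl
cut-identity false false = refl

agree-identity : ∀ f x y → not (f ∧ ((x ∧ not y) ∨ (not x ∧ y))) ≡ not f ∨ ⌊ x ≟ᵇ y ⌋
agree-identity false x     y     = refl
agree-identity true  true  true  = refl
agree-identity true  true  false = refl
agree-identity true  false true  = refl
agree-identity true  false false = refl

module Cuts {n : ℕ} (G : Graph n) (F : EdgeSet G) where
  open Connectivity G F

  Respects : Subset n → Set
  Respects L = ∀ e → T (e ∈ᵇ F) → lookup L (src e) ≡ lookup L (tgt e)

  respects⇔constant : ∀ L → Respects L ⇔ Constant (connected G F) L
  respects⇔constant L = mk⇔ (λ r u v c → along-walk r (Equivalence.to connected⇔walk c)) on-edges
    where
    along-walk : Respects L → ∀ {u v} → Walk u v → lookup L u ≡ lookup L v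
    along-walk r stay = refl
    along-walk r (p ▹ (e , e∈F , inj₁ (refl , refl))) = trans (along-walk r p) (r e e∈F)
    along-walk r (p ▹ (e , e∈F , inj₂ (refl , refl))) = trans (along-walk r p) (sym (r e e∈F))
    on-edges : Constant (connected G F) L → Respects L
    on-edges K e e∈F = K (src e) (tgt e) (Equivalence.from connected⇔walk (stay ▹ (e , e∈F , inj₁ (refl , refl))))

  isCut⇔complement : ∀ L R → T (isCut G (L , R)) ⇔ R ≡ complement L
  isCut⇔complement L R = mk⇔ to from
    where
    at : ∀ u → (not ((u ∈ᵇ L) ∧ (u ∈ᵇ R)) ∧ ((u ∈ᵇ L) ∨ (u ∈ᵇ R))) ≡ ⌊ lookup R u ≟ᵇ not (lookup L u) ⌋
    at u = trans (cong₂ (λ x y → not (x ∧ y) ∧ (x ∨ y)) (∈ᵇ-lookup u L) (∈ᵇ-lookup u R)) (cut-identity _ _)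
    to : T (isCut G (L , R)) → R ≡ complement L
    to h = vec-ext λ u → trans (toWitness (subst T (at u) (Equivalence.to (all-allFin _) h u))) (sym (lookup-map u not L))
    from : R ≡ complement L → T (isCut G (L , R))
    from refl = Equivalence.from (all-allFin _) λ u → subst T (sym (at u)) (fromWitness (lookup-map u not L))

  consistent⇔respects : ∀ L → T (consistent G F (L , complement L)) ⇔ Respects L
  consistent⇔respects L = mk⇔ to from
    where
    side : ∀ u → (u ∈ᵇ complement L) ≡ not (lookup L u)
    side u = trans (∈ᵇ-lookup u (complement L)) (lookup-map u not L)
    at : ∀ e → not ((e ∈ᵇ F) ∧ (((src e ∈ᵇ L) ∧ (tgt e ∈ᵇ complement L)) ∨ ((src e ∈ᵇ complement L) ∧ (tgt e ∈ᵇ L))))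
             ≡ not (e ∈ᵇ F) ∨ ⌊ lookup L (src e) ≟ᵇ lookup L (tgt e) ⌋
    at e rewrite ∈ᵇ-lookup (src e) L | ∈ᵇ-lookup (tgt e) L | side (src e) | side (tgt e) =
      agree-identity (e ∈ᵇ F) (lookup L (src e)) (lookup L (tgt e))
    to : T (consistent G F (L , complement L)) → Respects L
    to h e e∈F = toWitness (Equivalence.to T-→ (subst T (at e) (Equivalence.to (all-allFin _) h e)) e∈F)
    from : Respects L → T (consistent G F (L , complement L))
    from r = Equivalence.from (all-allFin _) λ e → subst T (sym (at e)) (Equivalence.from T-→ λ e∈F → fromWitness (r e e∈F))

  consistentCuts : ℕ
  consistentCuts = count (λ LR → isCut G LR ∧ consistent G F LR) (cartesianProduct (subsets n) (subsets n))

  -- Given L, the only candidate R is the complement of L, and it works iff L is constant on components.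
  cuts-with-left : ∀ L → count (λ R → isCut G (L , R) ∧ consistent G F (L , R)) (subsets n)
                         ≡ indicator (constant? (connected G F) L)
  cuts-with-left L = trans (count-subsets-unique _ (complement L) only-complement) (cong indicator (T-ext to from))
    where
    only-complement : ∀ R → T (isCut G (L , R) ∧ consistent G F (L , R)) → R ≡ complement L
    only-complement R h = Equivalence.to (isCut⇔complement L R) (proj₁ (T-∧-elim {isCut G (L , R)} h))
    to : T (isCut G (L , complement L) ∧ consistent G F (L , complement L)) → T (constant? (connected G F) L)
    to h = fromWitness (Equivalence.to (respects⇔constant L)
             (Equivalence.to (consistent⇔respects L) (proj₂ (T-∧-elim {isCut G (L , complement L)} h))))
    from : T (constant? (connected G F) L) → T (isCut G (L , complement L) ∧ consistent G F (L , complement L))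
    from K = T-∧-intro {isCut G (L , complement L)} (Equivalence.from (isCut⇔complement L _) refl)
               (Equivalence.from (consistent⇔respects L) (Equivalence.from (respects⇔constant L) (toWitness K)))

  consistentCuts≡ : consistentCuts ≡ 2 ^ classes (connected G F)
  consistentCuts≡ = begin
    consistentCuts
      ≡⟨ count-cartesianProduct (λ LR → isCut G LR ∧ consistent G F LR) (subsets n) (subsets n) ⟩
    sum (map (λ L → count (λ R → isCut G (L , R) ∧ consistent G F (L , R)) (subsets n)) (subsets n))
      ≡⟨ sum-cong cuts-with-left (subsets n) ⟩
    sum (map (indicator ∘ constant? (connected G F)) (subsets n))
      ≡⟨ count-as-sum (constant? (connected G F)) (subsets n) ⟨
    count (constant? (connected G F)) (subsets n)
      ≡⟨ count-constant n (connected G F) connected-equiv ⟩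
    2 ^ classes (connected G F) ∎
    where open ≡-Reasoning

module Degrees {n : ℕ} (G : Graph n) where
  open Endpoints G

  endpoints : ∀ F e → count (λ u → (e ∈ᵇ F) ∧ incident G u e) (allFin n) ≡ 2 * indicator (e ∈ᵇ F)
  endpoints F e with e ∈ᵇ F
  ... | false = count-none _ (allFin n) (λ _ ())
  ... | true  = trans (count-split _ (_== src e) (_== tgt e) one-end (allFin n))
                      (cong₂ _+_ (count-allFin-single (src e)) (count-allFin-single (tgt e)))
    where
    one-end : ∀ u → indicator ((u == src e) ∨ (u == tgt e)) ≡ indicator (u == src e) + indicator (u == tgt e)
    one-end u with u == src e in is-src | u == tgt e in is-tgt
    ... | false | _     = refl
    ... | true  | false = refl
    ... | true  | true  = ⊥-elim (noLoop G e (trans (sym (equal is-src)) (equal is-tgt)))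
      where
      equal : ∀ {i j : Fin n} → (i == j) ≡ true → i ≡ j
      equal eq = toWitness (subst T (sym eq) _)

  degree-sum : ∀ F → sum (map (deg G F) (allFin n)) ≡ 2 * ∣ F ∣
  degree-sum F = begin
    sum (map (λ u → count (λ e → (e ∈ᵇ F) ∧ incident G u e) (allFin (m G))) (allFin n))
      ≡⟨ count-swap (λ u e → (e ∈ᵇ F) ∧ incident G u e) (allFin n) (allFin (m G)) ⟩
    sum (map (λ e → count (λ u → (e ∈ᵇ F) ∧ incident G u e) (allFin n)) (allFin (m G)))
      ≡⟨ sum-cong (endpoints F) (allFin (m G)) ⟩
    sum (map (λ e → 2 * indicator (e ∈ᵇ F)) (allFin (m G)))
      ≡⟨ sum-scale 2 (λ e → indicator (e ∈ᵇ F)) (allFin (m G)) ⟩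
    2 * sum (map (λ e → indicator (e ∈ᵇ F)) (allFin (m G)))
      ≡⟨ cong (2 *_) (trans (∣∣-as-count F) (count-as-sum (_∈ᵇ F) (allFin (m G)))) ⟨
    2 * ∣ F ∣ ∎
    where open ≡-Reasoning

module Components {n : ℕ} (G : Graph n) (F : EdgeSet G) where
  open Connectivity G F

  C : Fin n → Fin n → Bool
  C = connected G F

  smallerTouched : Fin n → Fin n → Bool
  smallerTouched u v = (toℕ v <ᵇ toℕ u) ∧ touched G F v ∧ connected G F u v

  least-touched : ∀ u → touched G F u ∧ least? C u ≡ touched G F u ∧ all (λ v → not (smallerTouched u v)) (allFin n)
  least-touched u = T-ext to from
    where
    to : T (touched G F u ∧ least? C u) → T (touched G F u ∧ all (λ v → not (smallerTouched u v)) (allFin n))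
    to h = let (tu , lu) = T-∧-elim {touched G F u} h in
      T-∧-intro {touched G F u} tu (Equivalence.from (all-allFin (λ v → not (smallerTouched u v))) λ v →
        Equivalence.from T-not λ s → Equivalence.to (least⇔ C u) lu (mate s))
      where
      mate : ∀ {v} → T (smallerTouched u v) → HasSmallerMate C u
      mate {v} s = let (v<u , s′) = T-∧-elim {toℕ v <ᵇ toℕ u} s
                   in v , <ᵇ⇒< _ _ v<u , proj₂ (T-∧-elim {touched G F v} s′)
    from : T (touched G F u ∧ all (λ v → not (smallerTouched u v)) (allFin n)) → T (touched G F u ∧ least? C u)
    from h = let (tu , none) = T-∧-elim {touched G F u} h in
      T-∧-intro {touched G F u} tu (Equivalence.from (least⇔ C u) λ (v , v<u , c) →
        Equivalence.to T-not (Equivalence.to (all-allFin (λ v → not (smallerTouched u v))) none v)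
          (T-∧-intro {toℕ v <ᵇ toℕ u} (<⇒<ᵇ v<u)
            (T-∧-intro {touched G F v} (walk-end-touched (Equivalence.to connected⇔walk c) (smaller-≢ v<u)) c)))
      where
      smaller-≢ : ∀ {v} → toℕ v < toℕ u → u ≢ v
      smaller-≢ v<u refl = <-irrefl refl v<u

  -- An untouched vertex is alone in its class, hence least.
  least-untouched : ∀ u → not (touched G F u) ∧ least? C u ≡ not (touched G F u)
  least-untouched u = T-ext (λ h → proj₁ (T-∧-elim {not (touched G F u)} h)) from
    where
    from : T (not (touched G F u)) → T (not (touched G F u) ∧ least? C u)
    from nt = T-∧-intro {not (touched G F u)} nt (Equivalence.from (least⇔ C u) λ (v , v<u , c) →
      Equivalence.to T-not nt (walk-end-touched (reverse (Equivalence.to connected⇔walk c)) λ { refl → <-irrefl refl v<u }))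

  degree-0-or-2 : ∀ d → T ((d ≡ᵇ 0) ∨ (d ≡ᵇ 2)) → d ≡ 2 * indicator (not (d ≡ᵇ 0))
  degree-0-or-2 0                   _  = refl
  degree-0-or-2 1                   ()
  degree-0-or-2 2                   _  = refl
  degree-0-or-2 (suc (suc (suc d))) ()

  touched-count : ∀ ℓ → T (inR G ℓ F) → count (touched G F) (allFin n) ≡ ℓ
  touched-count ℓ h = *-cancelˡ-≡ _ _ 2 (begin
    2 * count (touched G F) (allFin n)
      ≡⟨ cong (2 *_) (count-as-sum (touched G F) (allFin n)) ⟩
    2 * sum (map (indicator ∘ touched G F) (allFin n))
      ≡⟨ sum-scale 2 (indicator ∘ touched G F) (allFin n) ⟨
    sum (map (λ u → 2 * indicator (touched G F u)) (allFin n))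
      ≡⟨ sum-cong (λ u → degree-0-or-2 (deg G F u) (Equivalence.to (all-allFin degree-test) regular u)) (allFin n) ⟨
    sum (map (deg G F) (allFin n))
      ≡⟨ Degrees.degree-sum G F ⟩
    2 * ∣ F ∣
      ≡⟨ cong (2 *_) (≡ᵇ⇒≡ ∣ F ∣ ℓ size) ⟩
    2 * ℓ ∎)
    where
    open ≡-Reasoning
    size : T (∣ F ∣ ≡ᵇ ℓ)
    size = proj₁ (T-∧-elim {∣ F ∣ ≡ᵇ ℓ} h)
    degree-test : Fin n → Bool
    degree-test u = (deg G F u ≡ᵇ 0) ∨ (deg G F u ≡ᵇ 2)
    regular : T (all degree-test (allFin n))
    regular = proj₂ (T-∧-elim {∣ F ∣ ≡ᵇ ℓ} h)

  -- Classes: one per component of F and one per untouched vertex.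
  classes≡ : ∀ ℓ → T (inR G ℓ F) → classes C ≡ n ∸ ℓ + cc G F
  classes≡ ℓ h = begin
    classes C
      ≡⟨ count-partition (touched G F) (least? C) (allFin n) ⟩
    count (λ u → touched G F u ∧ least? C u) (allFin n) + count (λ u → not (touched G F u) ∧ least? C u) (allFin n)
      ≡⟨ cong₂ _+_ (count-cong least-touched (allFin n)) (count-cong least-untouched (allFin n)) ⟩
    cc G F + count (not ∘ touched G F) (allFin n)
      ≡⟨ cong (cc G F +_) untouched ⟩
    cc G F + (n ∸ ℓ)
      ≡⟨ +-comm (cc G F) (n ∸ ℓ) ⟩
    n ∸ ℓ + cc G F ∎
    where
    open ≡-Reasoning
    untouched : count (not ∘ touched G F) (allFin n) ≡ n ∸ ℓ
    untouched = begin
      count (not ∘ touched G F) (allFin n)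
        ≡⟨ m+n∸m≡n ℓ _ ⟨
      ℓ + count (not ∘ touched G F) (allFin n) ∸ ℓ
        ≡⟨ cong (λ t → t + count (not ∘ touched G F) (allFin n) ∸ ℓ) (touched-count ℓ h) ⟨
      count (touched G F) (allFin n) + count (not ∘ touched G F) (allFin n) ∸ ℓ
        ≡⟨ cong (_∸ ℓ) (trans (count-complement (touched G F) (allFin n)) (length-tabulate (λ i → i))) ⟩
      n ∸ ℓ ∎

cuts-of-R : ∀ {n} (G : Graph n) ℓ F → T (inR G ℓ F) → Cuts.consistentCuts G F ≡ 2 ^ (n ∸ ℓ + cc G F)
cuts-of-R G ℓ F h = trans (Cuts.consistentCuts≡ G F) (cong (2 ^_) (Components.classes≡ G F ℓ h))

pow-split : ∀ a k c → k < c → 2 ^ (a + c) ≡ 2 ^ (a + k + 1) * 2 ^ (c ∸ suc k)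
pow-split a k c k<c = trans (cong (2 ^_) exponent) (^-distribˡ-+-* 2 (a + k + 1) (c ∸ suc k))
  where
  open ≡-Reasoning
  exponent : a + c ≡ a + k + 1 + (c ∸ suc k)
  exponent = begin
    a + c                         ≡⟨ cong (a +_) (m+[n∸m]≡n k<c) ⟨
    a + (suc k + (c ∸ suc k))     ≡⟨ +-assoc a (suc k) _ ⟨
    a + suc k + (c ∸ suc k)       ≡⟨ cong (λ s → a + s + (c ∸ suc k)) (+-comm 1 k) ⟩
    a + (k + 1) + (c ∸ suc k)     ≡⟨ cong (_+ (c ∸ suc k)) (+-assoc a k 1) ⟨
    a + k + 1 + (c ∸ suc k)       ∎

module Congruence {n : ℕ} (G : Graph n) (k ℓ : ℕ) (ω : Fin (m G) → ℤ) (w : ℤ) where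

  M : ℕ
  M = 2 ^ (n ∸ ℓ + k + 1)

  pairs : List (Subset n × Subset n)
  pairs = cartesianProduct (subsets n) (subsets n)

  small : EdgeSet G → ℕ
  small F = if inSw G k ℓ ω w F then 2 ^ (n ∸ ℓ + cc G F) else 0

  -- For F ∈ 𝓡_w with more than k components, 2 ^ (n-ℓ+cc(F)) = M * excess F.
  excess : EdgeSet G → ℕ
  excess F = if inRw G ℓ ω w F ∧ not (cc G F ≤ᵇ k) then 2 ^ (cc G F ∸ suc k) else 0

  split-term : ∀ isR isW few c cuts → (T isR → cuts ≡ 2 ^ (n ∸ ℓ + c)) → few ≡ (c ≤ᵇ k) →
    (if isR ∧ isW then cuts else 0)
      ≡ (if (isR ∧ few) ∧ isW then 2 ^ (n ∸ ℓ + c) else 0)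
        + M * (if (isR ∧ isW) ∧ not few then 2 ^ (c ∸ suc k) else 0)
  split-term false _     _     c cuts _    _   = sym (*-zeroʳ M)
  split-term true  false true  c cuts _    _   = sym (*-zeroʳ M)
  split-term true  false false c cuts _    _   = sym (*-zeroʳ M)
  split-term true  true  true  c cuts cuts≡ _  =
    trans (cuts≡ _) (sym (trans (cong (2 ^ (n ∸ ℓ + c) +_) (*-zeroʳ M)) (+-identityʳ _)))
  split-term true  true  false c cuts cuts≡ few≡ =
    trans (cuts≡ _) (pow-split (n ∸ ℓ) k c (≰⇒> λ c≤k → subst T (sym few≡) (≤⇒≤ᵇ c≤k)))

  contribution : ∀ F → count (λ LR → inRw G ℓ ω w F ∧ isCut G LR ∧ consistent G F LR) pairs ≡ small F + M * excess F
  contribution F = trans (count-guarded (inRw G ℓ ω w F) _ pairs)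
    (split-term (inR G ℓ F) _ (cc G F ≤ᵇ k) (cc G F) (Cuts.consistentCuts G F) (cuts-of-R G ℓ F) refl)

  sizeC-split : sizeC G ℓ ω w ≡ sumS G k ℓ ω w + M * sum (map excess (subsets (m G)))
  sizeC-split = begin
    sizeC G ℓ ω w
      ≡⟨ count-cartesianProduct _ (subsets (m G)) pairs ⟩
    sum (map (λ F → count (λ LR → inRw G ℓ ω w F ∧ isCut G LR ∧ consistent G F LR) pairs) (subsets (m G)))
      ≡⟨ sum-cong contribution (subsets (m G)) ⟩
    sum (map (λ F → small F + M * excess F) (subsets (m G)))
      ≡⟨ sum-+ small (λ F → M * excess F) (subsets (m G)) ⟩
    sum (map small (subsets (m G))) + sum (map (λ F → M * excess F) (subsets (m G)))
      ≡⟨ cong₂ _+_ (sum-filter (inSw G k ℓ ω w) (λ F → 2 ^ (n ∸ ℓ + cc G F)) (subsets (m G)))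
                   (sym (sum-scale M excess (subsets (m G)))) ⟨
    sumS G k ℓ ω w + M * sum (map excess (subsets (m G))) ∎
    where open ≡-Reasoning

-- The integer notation of the statement; its `+_` would clash with sections of ℕ addition above.
open import Data.Integer using (+_; _-_)

∣-difference : ∀ a b M X → a ≡ b + M * X → (+ M) ∣ (+ a - + b)
∣-difference a b M X refl = subst ((+ M) ∣_) (sym difference) (ℕ∣.m∣m*n X)
  where
  difference : + (b + M * X) - + b ≡ + (M * X)
  difference = trans (ℤP.[+m]-[+n]≡m⊖n (b + M * X) b) (trans (ℤP.⊖-≥ (m≤m+n b (M * X))) (cong +_ (m+n∸m≡n b (M * X))))

lemma2 : (n : ℕ) (G : Graph n) (k ℓ : ℕ) (ω : Fin (m G) → ℤ) (w : ℤ) →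
         (+ (2 ^ (n ∸ ℓ + k + 1))) ∣ (+ sizeC G ℓ ω w - + sumS G k ℓ ω w)
lemma2 n G k ℓ ω w = ∣-difference _ _ M _ sizeC-split
  where open Congruence G k ℓ ω w
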